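{- Let $\mu,\nu,\lambda\in\mathsf{Par}_2$ such that $|\mu|+|\nu|+|\lambda|$ is even and, for every $(A,A',B,B',C,C')\in\mathcal{G}_2$, $$0\leq \sum_{i\in A} \mu_i - \sum_{i\in A'} \mu_i + \sum_{j\in B} \nu_j - \sum_{j\in B'} \nu_j + \sum_{k\in C} \lambda_k - \sum_{k\in C'} \lambda_k .$$ Then $N_{\mu,\nu,\lambda}>0$.
   Context: $\mathsf{Par}_n=\{(\lambda_1,\dots,\lambda_n)\in\mathbb{Z}_{\ge0}^n:\lambda_1\ge\cdots\ge\lambda_n\}$, $|\lambda|=\sum_i\lambda_i$, $[n]=\{1,\dots,n\}$. $c^{\gamma}_{\alpha,\beta}$ denotes the Littlewood–Richardson coefficient (partitions identified up to trailing zeros). The Newell–Littlewood number is $N_{\mu,\nu,\lambda}=\sum_{\alpha,\beta,\gamma} c^{\mu}_{\alpha,\beta}c^{\nu}_{\alpha,\gamma}c^{\lambda}_{\beta,\gamma}$ over all partitions $\alpha,\beta,\gamma$. For a finite set $I=\{i_1<\cdots<i_d\}\subseteq\mathbb{Z}_{>0}$, $\tau(I)=(i_d-d\ge\cdots\ge i_2-2\ge i_1-1)$. $\mathcal{G}_n$ is the set of tuples $(A,A',B,B',C,C')$ of subsets of $[n]$ such that: (I) $A\cap A'=B\cap B'=C\cap C'=\emptyset$; (II) $|A|=|B'|+|C'|$, $|B|=|A'|+|C'|$, $|C|=|A'|+|B'|$; (III) there exist $A_1,A_2,B_1,B_2,C_1,C_2\subseteq[n]$ with (1) $|A_1|=|A_2|=|A'|$,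 $|B_1|=|B_2|=|B'|$, $|C_1|=|C_2|=|C'|$; (2) $c^{\tau(A')}_{\tau(A_1),\tau(A_2)}, c^{\tau(B')}_{\tau(B_1),\tau(B_2)}, c^{\tau(C')}_{\tau(C_1),\tau(C_2)}>0$; (3) $c^{\tau(A)}_{\tau(B_1),\tau(C_2)}, c^{\tau(B)}_{\tau(C_1),\tau(A_2)}, c^{\tau(C)}_{\tau(A_1),\tau(B_2)}>0$. -}

module Defs where

open import Data.Nat using (ℕ; zero; suc; _+_; _*_; _∸_; _≤_; _≤ᵇ_; _<ᵇ_; _≡ᵇ_)
open import Data.Bool using (Bool; true; false; _∧_; not; if_then_else_)
open import Data.List using (List; []; _∷_; [_]; length; map; concat; concatMap;
  applyUpTo; filterᵇ; reverse; inits; upTo; foldr)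
open import Data.Bool.ListAction using (and)
open import Data.Nat.ListAction using (sum)
open import Data.Vec using (Vec; lookup; toList)
open import Data.Fin using (Fin)
import Data.Fin as F
open import Data.Fin.Subset using (Subset; ∣_∣; _∩_; ⊥)
open import Data.Product using (Σ; _×_; _,_)
open import Data.Integer using (ℤ; +_; _-_) renaming (_+_ to _+ℤ_)
open import Relation.Binary.PropositionalEquality using (_≡_)

-- Partitions as lists of natural numbers (weakly decreasing).
-- Trailing zeros are identified by `norm`, which deletes zero parts
-- (on a weakly decreasing list this is exactly dropping trailing zeros).

at : List ℕ → ℕ → ℕ
at []       _       = 0
at (x ∷ xs) zero    = x
at (x ∷ xs) (suc i) = at xs i

norm : List ℕ → List ℕ
norm = filterᵇ (λ x → not (x ≡ᵇ 0))

words : ℕ → ℕ → List (List ℕ)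
words zero    m = [ [] ]
words (suc l) m = concatMap (λ w → map (_∷ w) (map suc (upTo m))) (words l m)

fillings : List ℕ → ℕ → List (List (List ℕ))
fillings []       m = [ [] ]
fillings (r ∷ rs) m =
  concatMap (λ w → map (w ∷_) (fillings rs m)) (words r m)

contained : List ℕ → List ℕ → Bool
contained α γ =
  (length α ≤ᵇ length γ) ∧ and (applyUpTo (λ i → at α i ≤ᵇ at γ i) (length α))

weakInc : List ℕ → Bool
weakInc []           = true
weakInc (x ∷ [])     = true
weakInc (x ∷ y ∷ xs) = (x ≤ᵇ y) ∧ weakInc (y ∷ xs)

count : ℕ → List ℕ → ℕ
count k = foldr (λ x n → if x ≡ᵇ k then suc n else n) 0

rowOf : List (List ℕ) → ℕ → List ℕ
rowOf []       _       = []
rowOf (r ∷ rs) zero    = r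
rowOf (r ∷ rs) (suc i) = rowOf rs i

-- A filling T of the skew shape γ/α is stored row by row: row i (0-indexed)
-- lists the entries in columns α_i, …, γ_i - 1 (0-indexed), left to right.
entry : List ℕ → List (List ℕ) → ℕ → ℕ → ℕ
entry α T i c = at (rowOf T i) (c ∸ at α i)

colStrict : List ℕ → List ℕ → List (List ℕ) → Bool
colStrict γ α T =
  and (applyUpTo (λ i →
    and (applyUpTo (λ j → let c = at α i + j in
           entry α T i c <ᵇ entry α T (suc i) c)
         (at γ (suc i) ∸ at α i)))
   (length γ ∸ 1))

hasContent : List ℕ → List (List ℕ) → Bool
hasContent β T =
  and (applyUpTo (λ k → count (suc k) (concat T) ≡ᵇ at β k) (length β))

lattice : ℕ → List ℕ → Bool
lattice m w =
  and (map (λ p → and (applyUpTo (λ k → count (suc (suc k)) p ≤ᵇ count (suc k) p)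
                                  (m ∸ 1)))
           (inits w))

isLR : List ℕ → List ℕ → List ℕ → List (List ℕ) → Bool
isLR γ α β T =
  and (map weakInc T) ∧ colStrict γ α T ∧ hasContent β T
    ∧ lattice (length β) (concat (map reverse T))

lrCount : List ℕ → List ℕ → List ℕ → ℕ
lrCount γ α β =
  if contained α γ
  then length (filterᵇ (isLR γ α β)
                 (fillings (applyUpTo (λ i → at γ i ∸ at α i) (length γ))
                           (length β)))
  else 0

-- Littlewood–Richardson coefficient c^γ_{α,β} (number of LR tableaux of
-- shape γ/α and content β); arguments are partitions up to trailing zeros.
LR : List ℕ → List ℕ → List ℕ → ℕ
LR γ α β = lrCount (norm γ) (norm α) (norm β)

-- partitions of n with all parts ≤ k, using fuel f ≥ n
partsF : ℕ → ℕ → ℕ → List (List ℕ)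
partsF _       zero    k = [ [] ]
partsF zero    (suc n) k = []
partsF (suc f) (suc n) k =
  concatMap (λ p → map (p ∷_) (partsF f (suc n ∸ p) p))
            (filterᵇ (λ p → p ≤ᵇ k) (map suc (upTo (suc n))))

partitionsOf : ℕ → List (List ℕ)
partitionsOf n = partsF n n n

partitionsUpTo : ℕ → List (List ℕ)
partitionsUpTo m = concatMap partitionsOf (upTo (suc m))

size : List ℕ → ℕ
size = sum

-- Newell–Littlewood number
--   N_{μ,ν,λ} = Σ_{α,β,γ} c^μ_{α,β} c^ν_{α,γ} c^λ_{β,γ}.
-- The sum is over all partitions; every term with |α| > |μ|, |β| > |μ| or
-- |γ| > |ν| vanishes (c^μ_{α,β} = 0 unless |α|+|β| = |μ|, c^ν_{α,γ} = 0
-- unless |α|+|γ| = |ν|), so the sum is taken over the finite range below.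
NL : List ℕ → List ℕ → List ℕ → ℕ
NL μ ν ρ =
  sum (concatMap (λ α → concatMap (λ β → map (λ γ →
         LR μ α β * LR ν α γ * LR ρ β γ)
       (partitionsUpTo (size ν)))
       (partitionsUpTo (size μ)))
     (partitionsUpTo (size μ)))

IsPar : {n : ℕ} → Vec ℕ n → Set
IsPar {n} v = (i j : Fin n) → i F.≤ j → lookup v j ≤ lookup v i

asPartition : {n : ℕ} → Vec ℕ n → List ℕ
asPartition v = toList v

-- subsets of [n] = {1,…,n}: Fin n position p represents the element p+1.
-- τ(I) for I = {i_1 < … < i_d}: (i_d - d ≥ … ≥ i_1 - 1).
-- helper: scan positions; `p` = current element of [n] (1-based),
-- `j` = number of elements of I seen so far; emits i_j - j in increasing order.
tauScan : List Bool → ℕ → ℕ → List ℕ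
tauScan []          p j = []
tauScan (b ∷ bs)    p j =
  if b then (p ∸ suc j) ∷ tauScan bs (suc p) (suc j)
       else tauScan bs (suc p) j

τ : {n : ℕ} → Subset n → List ℕ
τ I = reverse (tauScan (toList I) 1 0)

sumOver : {n : ℕ} → Subset n → Vec ℕ n → ℕ
sumOver {zero}  _ _ = 0
sumOver {suc n} A v =
  (if lookup A F.zero then lookup v F.zero else 0)
  + sumOver {n} (Data.Vec.tail A) (Data.Vec.tail v)
  where import Data.Vec

Disjoint : {n : ℕ} → Subset n → Subset n → Set
Disjoint A A' = A ∩ A' ≡ ⊥

LRpos : List ℕ → List ℕ → List ℕ → Set
LRpos γ α β = 0 Data.Nat.< LR γ α β
  where import Data.Nat

InG : (n : ℕ) → (A A' B B' C C' : Subset n) → Set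
InG n A A' B B' C C' =
  (Disjoint A A' × Disjoint B B' × Disjoint C C')
  × (∣ A ∣ ≡ ∣ B' ∣ + ∣ C' ∣ × ∣ B ∣ ≡ ∣ A' ∣ + ∣ C' ∣ × ∣ C ∣ ≡ ∣ A' ∣ + ∣ B' ∣)
  × Σ (Subset n) λ A₁ → Σ (Subset n) λ A₂ → Σ (Subset n) λ B₁ →
    Σ (Subset n) λ B₂ → Σ (Subset n) λ C₁ → Σ (Subset n) λ C₂ →
      (∣ A₁ ∣ ≡ ∣ A' ∣ × ∣ A₂ ∣ ≡ ∣ A' ∣ × ∣ B₁ ∣ ≡ ∣ B' ∣ × ∣ B₂ ∣ ≡ ∣ B' ∣
        × ∣ C₁ ∣ ≡ ∣ C' ∣ × ∣ C₂ ∣ ≡ ∣ C' ∣)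
    × (LRpos (τ A') (τ A₁) (τ A₂) × LRpos (τ B') (τ B₁) (τ B₂)
        × LRpos (τ C') (τ C₁) (τ C₂))
    × (LRpos (τ A) (τ B₁) (τ C₂) × LRpos (τ B) (τ C₁) (τ A₂)
        × LRpos (τ C) (τ A₁) (τ B₂))

ineqForm : {n : ℕ} → (μ ν ρ : Vec ℕ n) → (A A' B B' C C' : Subset n) → ℤ
ineqForm μ ν ρ A A' B B' C C' =
  ((((+ sumOver A μ - + sumOver A' μ) +ℤ + sumOver B ν) - + sumOver B' ν)
     +ℤ + sumOver C ρ) - + sumOver C' ρ

-- Write a two-row partition by its size and its spin, the difference of its two rows.  For
-- two-row shapes, c^γ_{α,β} > 0 exactly when |γ| = |α| + |β| and the spins of γ, α, β satisfy
-- the triangle inequality (the Clebsch–Gordan rule); an explicit Littlewood–Richardson tableau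
-- realises this.  So N_{μ,ν,λ} > 0 as soon as there are α, β, γ with c^μ_{α,β}, c^ν_{α,γ},
-- c^λ_{β,γ} > 0.  Their sizes are forced, |α| = (|μ| + |ν| - |λ|)/2 and so on, and are natural
-- numbers by the parity hypothesis and the inequalities |λ| ≤ |μ| + |ν| of 𝒢₂.  For their spins
-- take the largest values allowed by "spin ≤ size" and the triangle inequalities, i.e. shortest
-- paths around the triangle with vertices α, β, γ and edge lengths the spins of μ, ν, λ.  These
-- satisfy the upper triangle inequalities and have the parity of the sizes automatically; the
-- lower triangle inequalities follow from the remaining inequalities of 𝒢₂.
module Submission where

open import Defs
open import Data.Nat
open import Data.Nat.Properties
open import Data.Nat.Divisibility using (_∣_; divides; ∣m+n∣m⇒∣n; ∣m∣n⇒∣m+n)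
open import Data.Nat.Tactic.RingSolver using (solve)
open import Data.List using (List; _∷_; [])
open import Data.Product using (∃; _×_; _,_; proj₁; proj₂)
open import Data.Sum using (inj₁; inj₂)
open import Relation.Binary.PropositionalEquality hiding ([_])
open ≡-Reasoning

record ClebschGordan (g₁ g₂ a₁ a₂ b₁ b₂ : ℕ) : Set where
  field
    |g|≡|a|+|b| : g₁ + g₂ ≡ (a₁ + a₂) + (b₁ + b₂)
    a₂+b₂≤g₂    : a₂ + b₂ ≤ g₂
    g₂≤a₁+b₂    : g₂ ≤ a₁ + b₂
    g₂≤a₂+b₁    : g₂ ≤ a₂ + b₁

-- Maximal spins

≤-+⊓ : ∀ {a} c {p q} → a ≤ c + p → a ≤ c + q → a ≤ c + (p ⊓ q)
≤-+⊓ c {p} {q} a≤c+p a≤c+q = subst (_ ≤_) (sym (+-distribˡ-⊓ c p q)) (⊓-glb a≤c+p a≤c+q)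

≤-⊓+ : ∀ {a p q} c → a ≤ p + c → a ≤ q + c → a ≤ (p ⊓ q) + c
≤-⊓+ {p = p} {q} c a≤p+c a≤q+c = subst (_ ≤_) (sym (+-distribʳ-⊓ c p q)) (⊓-glb a≤p+c a≤q+c)

≤-+[+⊓] : ∀ {a} c d {p q} → a ≤ c + (d + p) → a ≤ c + (d + q) → a ≤ c + (d + (p ⊓ q))
≤-+[+⊓] c d {p} {q} a≤p a≤q = subst (λ w → _ ≤ c + w) (sym (+-distribˡ-⊓ d p q)) (≤-+⊓ c a≤p a≤q)

≤-[+⊓]+ : ∀ {a} d {p q} c → a ≤ (d + p) + c → a ≤ (d + q) + c → a ≤ (d + (p ⊓ q)) + c
≤-[+⊓]+ d {p} {q} c a≤p a≤q = subst (λ w → _ ≤ w + c) (sym (+-distribˡ-⊓ d p q)) (≤-⊓+ c a≤p a≤q)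

≤-slack : ∀ {a b c} d → a ≤ b → b + d ≡ c → a ≤ c
≤-slack d a≤b refl = ≤-trans a≤b (m≤m+n _ d)

-- The vertex of size x is joined to the vertices of sizes y and z by edges of spins e and f,
-- and g is the spin of the edge between y and z.
spinBound : ℕ → ℕ → ℕ → ℕ → ℕ → ℕ → ℕ
spinBound x y z e f g = x ⊓ ((e + (y ⊓ (g + z))) ⊓ (f + (z ⊓ (g + y))))

spinBound≤size : ∀ x y z e f g → spinBound x y z e f g ≤ x
spinBound≤size x y z e f g = m⊓n≤m _ _

spinBound-swap : ∀ x y z e f g → spinBound x y z e f g ≡ spinBound x z y f e g
spinBound-swap x y z e f g = cong (x ⊓_) (⊓-comm _ _)

spinBound≤spin+spinBound : ∀ x y z e f g → spinBound x y z e f g ≤ e + spinBound y x z e g f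
spinBound≤spin+spinBound x y z e f g =
  ≤-+⊓ e (≤-trans σ≤e+[y⊓g+z] (+-monoʳ-≤ e (m⊓n≤m y _)))
         (≤-+⊓ e (≤-trans (⊓-glb σ≤x σ≤f+z) (≤-trans (m≤n+m _ e) (m≤n+m _ e)))
                 (subst (σ ≤_) (+-assoc e g _)
                        (≤-+⊓ (e + g) (subst (σ ≤_) (sym (+-assoc e g z)) σ≤e+g+z)
                                      (≤-trans σ≤x (≤-trans (m≤n+m x f) (m≤n+m _ (e + g)))))))
  where
  σ : ℕ
  σ = spinBound x y z e f g
  σ≤x : σ ≤ x
  σ≤x = m⊓n≤m x _
  σ≤e+[y⊓g+z] : σ ≤ e + (y ⊓ (g + z))
  σ≤e+[y⊓g+z] = ≤-trans (m⊓n≤n x _) (m⊓n≤m _ _)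
  σ≤e+g+z : σ ≤ e + (g + z)
  σ≤e+g+z = ≤-trans σ≤e+[y⊓g+z] (+-monoʳ-≤ e (m⊓n≤n y _))
  σ≤f+z : σ ≤ f + z
  σ≤f+z = ≤-trans (m⊓n≤n x _) (≤-trans (m⊓n≤n _ _) (+-monoʳ-≤ f (m⊓n≤m z _)))

record SpinInequalities (e f g x y z : ℕ) : Set where
  field
    e≤x+y    : e ≤ x + y
    e≤x+g+z  : e ≤ x + (g + z)
    e≤f+z+y  : e ≤ (f + z) + y
    e≤f+g+2x : e ≤ x + (g + (f + x))
    e≤f+g+2y : e ≤ (f + (g + y)) + y
    e≤f+g+2z : e ≤ (f + z) + (g + z)

spin≤spinBound+spinBound : ∀ {x y z e f g} → SpinInequalities e f g x y z →
                           e ≤ spinBound x y z e f g + spinBound y x z e g f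
spin≤spinBound+spinBound {x} {y} {z} {e} {f} {g} h =
  ≤-⊓+ σβ e≤x+σβ (≤-⊓+ σβ (e≤[e+]+ _ σβ) e≤Fα+σβ)
  where
  open SpinInequalities h
  Fα Gβ σβ : ℕ
  Fα = f + (z ⊓ (g + y))
  Gβ = g + (z ⊓ (f + x))
  σβ = spinBound y x z e g f
  e≤+[e+] : ∀ v w → e ≤ v + (e + w)
  e≤+[e+] v w = ≤-trans (m≤m+n e w) (m≤n+m _ v)
  e≤[e+]+ : ∀ w v → e ≤ (e + w) + v
  e≤[e+]+ w v = ≤-trans (m≤m+n e w) (m≤m+n _ v)
  e≤x+σβ : e ≤ x + σβ
  e≤x+σβ = ≤-+⊓ x e≤x+y (≤-+⊓ x (e≤+[e+] x _) (≤-+[+⊓] x g e≤x+g+z e≤f+g+2x))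
  e≤Fα+Gβ : e ≤ Fα + Gβ
  e≤Fα+Gβ = ≤-[+⊓]+ f Gβ
    (≤-+[+⊓] (f + z) g e≤f+g+2z (≤-slack (f + f) e≤x+g+z (solve (x ∷ z ∷ f ∷ g ∷ []))))
    (≤-+[+⊓] (f + (g + y)) g (≤-slack (g + g) e≤f+z+y (solve (y ∷ z ∷ f ∷ g ∷ [])))
                             (≤-slack (f + g + f + g) e≤x+y (solve (x ∷ y ∷ f ∷ g ∷ []))))
  e≤Fα+σβ : e ≤ Fα + σβ
  e≤Fα+σβ = ≤-+⊓ Fα (≤-[+⊓]+ f y e≤f+z+y e≤f+g+2y) (≤-+⊓ Fα (e≤+[e+] Fα _) e≤Fα+Gβ)

infix 4 _≡₂_
record _≡₂_ (x y : ℕ) : Set where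
  constructor sameParity
  field 2∣x+y : 2 ∣ x + y

≡₂-refl : ∀ x → x ≡₂ x
≡₂-refl x = sameParity (divides x (solve (x ∷ [])))

≡₂-trans : ∀ {x y z} → x ≡₂ y → y ≡₂ z → x ≡₂ z
≡₂-trans {x} {y} {z} (sameParity 2∣x+y) (sameParity 2∣y+z) =
  sameParity (∣m+n∣m⇒∣n (subst (2 ∣_) eq (∣m∣n⇒∣m+n 2∣x+y 2∣y+z)) (divides y refl))
  where
  eq : (x + y) + (y + z) ≡ y * 2 + (x + z)
  eq = solve (x ∷ y ∷ z ∷ [])

≡₂-+ˡ : ∀ w {x y} → x ≡₂ y → w + x ≡₂ w + y
≡₂-+ˡ w {x} {y} (sameParity 2∣x+y) = sameParity (subst (2 ∣_) eq (∣m∣n⇒∣m+n 2∣x+y (divides w refl)))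
  where
  eq : (x + y) + w * 2 ≡ (w + x) + (w + y)
  eq = solve (w ∷ x ∷ y ∷ [])

≡₂-⊓ : ∀ {x y z} → x ≡₂ y → x ≡₂ z → x ≡₂ y ⊓ z
≡₂-⊓ {x} {y} {z} x≡₂y x≡₂z with ⊓-sel y z
... | inj₁ y⊓z≡y = subst (x ≡₂_) (sym y⊓z≡y) x≡₂y
... | inj₂ y⊓z≡z = subst (x ≡₂_) (sym y⊓z≡z) x≡₂z

≡₂-split : ∀ {σ x} → σ ≤ x → x ≡₂ σ → ∃ λ k → x ≡ σ + k * 2
≡₂-split {σ} σ≤x (sameParity 2∣x+σ) with m≤n⇒∃[o]m+o≡n σ≤x
... | d , refl with ∣m+n∣m⇒∣n (subst (2 ∣_) (eq σ d) 2∣x+σ) (divides σ refl)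
  where
  eq : ∀ σ d → (σ + d) + σ ≡ σ * 2 + d
  eq σ d = solve (σ ∷ d ∷ [])
... | divides k refl = k , refl

≡₂-edge : ∀ {x y} r {e} → x + y ≡ (r + e) + r → x ≡₂ e + y
≡₂-edge {x} {y} r {e} x+y≡ = sameParity (divides (r + e) (begin
  x + (e + y)      ≡⟨ solve (x ∷ y ∷ e ∷ []) ⟩
  (x + y) + e      ≡⟨ cong (_+ e) x+y≡ ⟩
  (r + e + r) + e  ≡⟨ solve (r ∷ e ∷ []) ⟩
  (r + e) * 2      ∎))

-- The edge joining sizes x and y is a partition (r + e, r) of size x + y and spin e.
spinBound-parity : ∀ x y z e f g {r p q} →
  x + y ≡ (r + e) + r → x + z ≡ (p + f) + p → y + z ≡ (q + g) + q →
  x ≡₂ spinBound x y z e f g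
spinBound-parity x y z e f g {r} {p} {q} x+y x+z y+z =
  ≡₂-⊓ (≡₂-refl x) (≡₂-⊓ (≡₂-trans (≡₂-edge r x+y) (≡₂-+ˡ e y≡₂y⊓g+z))
                         (≡₂-trans (≡₂-edge p x+z) (≡₂-+ˡ f z≡₂z⊓g+y)))
  where
  y≡₂y⊓g+z : y ≡₂ y ⊓ (g + z)
  y≡₂y⊓g+z = ≡₂-⊓ (≡₂-refl y) (≡₂-edge q y+z)
  z≡₂z⊓g+y : z ≡₂ z ⊓ (g + y)
  z≡₂z⊓g+y = ≡₂-⊓ (≡₂-refl z) (≡₂-edge q (trans (+-comm z y) y+z))

spinBound-halves : ∀ x y z e f g {r p q} →
  x + y ≡ (r + e) + r → x + z ≡ (p + f) + p → y + z ≡ (q + g) + q →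
  ∃ λ k → x ≡ spinBound x y z e f g + k * 2
spinBound-halves x y z e f g {r} {p} {q} x+y x+z y+z =
  ≡₂-split (spinBound≤size x y z e f g) (spinBound-parity x y z e f g {r} {p} {q} x+y x+z y+z)

halve-≤ : ∀ {p q m n} → p + m * 2 ≡ q + n * 2 → q ≤ p → m ≤ n
halve-≤ {p} {q} {m} {n} eq q≤p with m≤n⇒∃[o]m+o≡n q≤p
... | d , refl =
  *-cancelʳ-≤ m n 2 (≤-trans (m≤n+m (m * 2) d) (≤-reflexive (+-cancelˡ-≡ q _ _ (trans (sym (+-assoc q d _)) eq))))

-- A partition of size x and spin σx has rows (σx + kx, kx) where x = σx + 2 kx.
clebschGordan-fromSpins : ∀ {r e σx σy kx ky} →
  (σx + kx * 2) + (σy + ky * 2) ≡ (r + e) + r →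
  e ≤ σx + σy → σx ≤ e + σy → σy ≤ e + σx →
  ClebschGordan (r + e) r (σx + kx) kx (σy + ky) ky
clebschGordan-fromSpins {r} {e} {σx} {σy} {kx} {ky} sizes e≤ σx≤ σy≤ = record
  { |g|≡|a|+|b| = begin
      (r + e) + r                              ≡⟨ sizes ⟨
      (σx + kx * 2) + (σy + ky * 2)            ≡⟨ solve (σx ∷ σy ∷ kx ∷ ky ∷ []) ⟩
      ((σx + kx) + kx) + ((σy + ky) + ky)      ∎
  ; a₂+b₂≤g₂ = halve-≤ (begin
      (σx + σy) + (kx + ky) * 2                ≡⟨ solve (σx ∷ σy ∷ kx ∷ ky ∷ []) ⟩
      (σx + kx * 2) + (σy + ky * 2)            ≡⟨ sizes ⟩
      (r + e) + r                              ≡⟨ solve (r ∷ e ∷ []) ⟩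
      e + r * 2                                ∎) e≤
  ; g₂≤a₁+b₂ = halve-≤ (begin
      (e + σx) + r * 2                         ≡⟨ solve (r ∷ e ∷ σx ∷ []) ⟩
      σx + ((r + e) + r)                       ≡⟨ cong (σx +_) sizes ⟨
      σx + ((σx + kx * 2) + (σy + ky * 2))     ≡⟨ solve (σx ∷ σy ∷ kx ∷ ky ∷ []) ⟩
      σy + ((σx + kx) + ky) * 2                ∎) σy≤
  ; g₂≤a₂+b₁ = halve-≤ (begin
      (e + σy) + r * 2                         ≡⟨ solve (r ∷ e ∷ σy ∷ []) ⟩
      σy + ((r + e) + r)                       ≡⟨ cong (σy +_) sizes ⟨
      σy + ((σx + kx * 2) + (σy + ky * 2))     ≡⟨ solve (σx ∷ σy ∷ kx ∷ ky ∷ []) ⟩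
      σx + (kx + (σy + ky)) * 2                ∎) σx≤
  }

edgeClebschGordan : ∀ {x y z e f g r σx σy} kx ky → SpinInequalities e f g x y z →
  x + y ≡ (r + e) + r →
  spinBound x y z e f g ≡ σx → spinBound y x z e g f ≡ σy →
  x ≡ σx + kx * 2 → y ≡ σy + ky * 2 →
  ClebschGordan (r + e) r (σx + kx) kx (σy + ky) ky
edgeClebschGordan {x} {y} {z} {e} {f} {g} {r} {σx} {σy} kx ky h x+y σx≡ σy≡ x≡ y≡ =
  clebschGordan-fromSpins {r} {e} {σx} {σy} {kx} {ky} (trans (sym (cong₂ _+_ x≡ y≡)) x+y)
    (subst₂ (λ p q → e ≤ p + q) σx≡ σy≡ (spin≤spinBound+spinBound h))
    (subst₂ (λ p q → p ≤ e + q) σx≡ σy≡ (spinBound≤spin+spinBound x y z e f g))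
    (subst₂ (λ p q → q ≤ e + p) σx≡ σy≡ (spinBound≤spin+spinBound y x z e g f))

twoRowSolution : ∀ {a b c m₂ s n₂ t l₂ u} →
  a + b ≡ (m₂ + s) + m₂ → a + c ≡ (n₂ + t) + n₂ → b + c ≡ (l₂ + u) + l₂ →
  SpinInequalities s t u a b c → SpinInequalities t s u a c b → SpinInequalities u s t b c a →
  ∃ λ ((α₁ , α₂ , β₁ , β₂ , γ₁ , γ₂) : ℕ × ℕ × ℕ × ℕ × ℕ × ℕ) →
    ClebschGordan (m₂ + s) m₂ α₁ α₂ β₁ β₂ × ClebschGordan (n₂ + t) n₂ α₁ α₂ γ₁ γ₂ ×
    ClebschGordan (l₂ + u) l₂ β₁ β₂ γ₁ γ₂
twoRowSolution {a} {b} {c} {m₂} {s} {n₂} {t} {l₂} {u} a+b a+c b+c hμ hν hλ =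
  (σα + kα , kα , σβ + kβ , kβ , σγ + kγ , kγ) ,
  edgeClebschGordan kα kβ hμ a+b refl refl a≡ b≡ ,
  edgeClebschGordan kα kγ hν a+c (sym (spinBound-swap a b c s t u)) refl a≡ c≡ ,
  edgeClebschGordan kβ kγ hλ b+c (sym (spinBound-swap b a c s u t)) (sym (spinBound-swap c a b t u s)) b≡ c≡
  where
  σα σβ σγ : ℕ
  σα = spinBound a b c s t u
  σβ = spinBound b a c s u t
  σγ = spinBound c a b t u s
  α-halves : ∃ λ k → a ≡ σα + k * 2
  α-halves = spinBound-halves a b c s t u {m₂} {n₂} {l₂} a+b a+c b+c
  β-halves : ∃ λ k → b ≡ σβ + k * 2
  β-halves = spinBound-halves b a c s u t {m₂} {l₂} {n₂} (trans (+-comm b a) a+b) b+c a+c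
  γ-halves : ∃ λ k → c ≡ σγ + k * 2
  γ-halves = spinBound-halves c a b t u s {n₂} {l₂} {m₂} (trans (+-comm c a) a+c) (trans (+-comm c b) b+c) a+b
  kα kβ kγ : ℕ
  kα = proj₁ α-halves
  kβ = proj₁ β-halves
  kγ = proj₁ γ-halves
  a≡ : a ≡ σα + kα * 2
  a≡ = proj₂ α-halves
  b≡ : b ≡ σβ + kβ * 2
  b≡ = proj₂ β-halves
  c≡ : c ≡ σγ + kγ * 2
  c≡ = proj₂ γ-halves

-- The inequalities of 𝒢₂ that bound the spin s of μ = (m₂ + s, m₂), where ν = (n₂ + t, n₂) and
-- λ = (l₂ + u, l₂).
record HornInequalities (m₂ s n₂ t l₂ u : ℕ) : Set where
  field
    m₁+n₂≤m₂+n₁+|λ| : (m₂ + s) + n₂ ≤ m₂ + ((n₂ + t) + ((l₂ + u) + l₂))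
    m₁+l₂≤m₂+l₁+|ν| : (m₂ + s) + l₂ ≤ m₂ + ((n₂ + t) + (n₂ + (l₂ + u)))
    l₂≤m₂+n₁        : l₂ ≤ m₂ + (n₂ + t)
    n₂≤m₂+l₁        : n₂ ≤ m₂ + (l₂ + u)
    m₁≤n₁+l₁        : m₂ + s ≤ (n₂ + t) + (l₂ + u)

≤-cancelʳ : ∀ {p q p′ q′} d → p ≤ q → p ≡ p′ + d → q ≡ q′ + d → p′ ≤ q′
≤-cancelʳ {p′ = p′} {q′} d p≤q refl refl = +-cancelʳ-≤ d p′ q′ p≤q

double-≤ : ∀ {p q} c → p ≤ q → p * 2 + c ≤ q * 2 + c
double-≤ c p≤q = +-monoˡ-≤ c (*-monoˡ-≤ 2 p≤q)

spinInequalities : ∀ {a b c m₂ s n₂ t l₂ u} →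
  a + b ≡ (m₂ + s) + m₂ → a + c ≡ (n₂ + t) + n₂ → b + c ≡ (l₂ + u) + l₂ →
  HornInequalities m₂ s n₂ t l₂ u → SpinInequalities s t u a b c
spinInequalities {a} {b} {c} {m₂} {s} {n₂} {t} {l₂} {u} a+b a+c b+c h = record
  { e≤x+y    = subst (s ≤_) (sym a+b) (≤-trans (m≤n+m s m₂) (m≤m+n _ m₂))
  ; e≤x+g+z  = ≤-cancelʳ (m₂ + l₂) m₁+l₂≤m₂+l₁+|ν| (solve (m₂ ∷ s ∷ l₂ ∷ [])) (begin
      m₂ + ((n₂ + t) + (n₂ + (l₂ + u)))              ≡⟨ solve (m₂ ∷ n₂ ∷ t ∷ l₂ ∷ u ∷ []) ⟩
      (m₂ + (l₂ + u)) + ((n₂ + t) + n₂)              ≡⟨ cong ((m₂ + (l₂ + u)) +_) a+c ⟨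
      (m₂ + (l₂ + u)) + (a + c)                      ≡⟨ solve (a ∷ c ∷ m₂ ∷ l₂ ∷ u ∷ []) ⟩
      (a + (u + c)) + (m₂ + l₂)                      ∎)
  ; e≤f+z+y  = ≤-cancelʳ (m₂ + n₂) m₁+n₂≤m₂+n₁+|λ| (solve (m₂ ∷ s ∷ n₂ ∷ [])) (begin
      m₂ + ((n₂ + t) + ((l₂ + u) + l₂))              ≡⟨ cong (λ w → m₂ + ((n₂ + t) + w)) b+c ⟨
      m₂ + ((n₂ + t) + (b + c))                      ≡⟨ solve (b ∷ c ∷ m₂ ∷ n₂ ∷ t ∷ []) ⟩
      ((t + c) + b) + (m₂ + n₂)                      ∎)
  ; e≤f+g+2x = ≤-cancelʳ (b + c) (double-≤ (s + u) l₂≤m₂+n₁) (begin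
      l₂ * 2 + (s + u)                               ≡⟨ solve (s ∷ l₂ ∷ u ∷ []) ⟩
      s + ((l₂ + u) + l₂)                            ≡⟨ cong (s +_) b+c ⟨
      s + (b + c)                                    ∎) (begin
      (m₂ + (n₂ + t)) * 2 + (s + u)                  ≡⟨ solve (m₂ ∷ s ∷ n₂ ∷ t ∷ u ∷ []) ⟩
      (u + t) + (((m₂ + s) + m₂) + ((n₂ + t) + n₂))  ≡⟨ cong₂ (λ v w → (u + t) + (v + w)) a+b a+c ⟨
      (u + t) + ((a + b) + (a + c))                  ≡⟨ solve (a ∷ b ∷ c ∷ t ∷ u ∷ []) ⟩
      (a + (u + (t + a))) + (b + c)                  ∎)
  ; e≤f+g+2y = ≤-cancelʳ (a + c) (double-≤ (s + t) n₂≤m₂+l₁) (begin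
      n₂ * 2 + (s + t)                               ≡⟨ solve (s ∷ n₂ ∷ t ∷ []) ⟩
      s + ((n₂ + t) + n₂)                            ≡⟨ cong (s +_) a+c ⟨
      s + (a + c)                                    ∎) (begin
      (m₂ + (l₂ + u)) * 2 + (s + t)                  ≡⟨ solve (m₂ ∷ s ∷ l₂ ∷ t ∷ u ∷ []) ⟩
      (t + u) + (((m₂ + s) + m₂) + ((l₂ + u) + l₂))  ≡⟨ cong₂ (λ v w → (t + u) + (v + w)) a+b b+c ⟨
      (t + u) + ((a + b) + (b + c))                  ≡⟨ solve (a ∷ b ∷ c ∷ t ∷ u ∷ []) ⟩
      ((t + (u + b)) + b) + (a + c)                  ∎)
  ; e≤f+g+2z = ≤-cancelʳ (a + b) (double-≤ 0 m₁≤n₁+l₁) (begin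
      (m₂ + s) * 2 + 0                               ≡⟨ solve (m₂ ∷ s ∷ []) ⟩
      s + ((m₂ + s) + m₂)                            ≡⟨ cong (s +_) a+b ⟨
      s + (a + b)                                    ∎) (begin
      ((n₂ + t) + (l₂ + u)) * 2 + 0                  ≡⟨ solve (n₂ ∷ t ∷ l₂ ∷ u ∷ []) ⟩
      (t + u) + (((n₂ + t) + n₂) + ((l₂ + u) + l₂))  ≡⟨ cong₂ (λ v w → (t + u) + (v + w)) a+c b+c ⟨
      (t + u) + ((a + c) + (b + c))                  ≡⟨ solve (a ∷ b ∷ c ∷ t ∷ u ∷ []) ⟩
      ((t + c) + (u + c)) + (a + b)                  ∎)
  }
  where open HornInequalities h

half-≤ : ∀ {X Y q} → X ≤ Y → X + Y ≡ q * 2 → X ≤ q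
half-≤ {X} {Y} {q} X≤Y X+Y≡q*2 =
  *-cancelʳ-≤ X q 2 (≤-trans (≤-reflexive X*2≡X+X) (≤-trans (+-monoʳ-≤ X X≤Y) (≤-reflexive X+Y≡q*2)))
  where
  X*2≡X+X : X * 2 ≡ X + X
  X*2≡X+X = solve (X ∷ [])

half-sum : ∀ {X} Y Z {x y q} → Y + x ≡ q → Z + y ≡ q → X + (Y + Z) ≡ q * 2 → x + y ≡ X
half-sum {X} Y Z {x} {y} {q} Y+x≡q Z+y≡q total = +-cancelʳ-≡ (Y + Z) (x + y) X (begin
  (x + y) + (Y + Z)   ≡⟨ solve (x ∷ y ∷ Y ∷ Z ∷ []) ⟩
  (Y + x) + (Z + y)   ≡⟨ cong₂ _+_ Y+x≡q Z+y≡q ⟩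
  q + q               ≡⟨ solve (q ∷ []) ⟩
  q * 2               ≡⟨ total ⟨
  X + (Y + Z)         ∎)

vertexSizes : ∀ {M N L} q → L ≤ M + N → N ≤ M + L → M ≤ N + L → M + N + L ≡ q * 2 →
              ∃ λ ((a , b , c) : ℕ × ℕ × ℕ) → a + b ≡ M × a + c ≡ N × b + c ≡ L
vertexSizes {M} {N} {L} q L≤M+N N≤M+L M≤N+L total
  with m≤n⇒∃[o]m+o≡n (half-≤ {q = q} L≤M+N (trans (+-comm L (M + N)) total))
     | m≤n⇒∃[o]m+o≡n (half-≤ {q = q} N≤M+L (trans N+[M+L] total))
     | m≤n⇒∃[o]m+o≡n (half-≤ {q = q} M≤N+L (trans (sym (+-assoc M N L)) total))
  where
  N+[M+L] : N + (M + L) ≡ M + N + L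
  N+[M+L] = solve (M ∷ N ∷ L ∷ [])
... | a , L+a≡q | b , N+b≡q | c , M+c≡q =
  (a , b , c) , half-sum L N L+a≡q N+b≡q (trans M+[L+N] total)
              , half-sum L M L+a≡q M+c≡q (trans N+[L+M] total)
              , half-sum N M N+b≡q M+c≡q (trans L+[N+M] total)
  where
  M+[L+N] : M + (L + N) ≡ M + N + L
  M+[L+N] = solve (M ∷ N ∷ L ∷ [])
  N+[L+M] : N + (L + M) ≡ M + N + L
  N+[L+M] = solve (M ∷ N ∷ L ∷ [])
  L+[N+M] : L + (N + M) ≡ M + N + L
  L+[N+M] = solve (M ∷ N ∷ L ∷ [])

-- Two-row Littlewood–Richardson tableaux

open import Data.Bool using (true; false; T; _∧_; not; if_then_else_)
open import Data.Bool.Properties using (T-∧)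
open import Data.Bool.ListAction using (and)
open import Data.Nat.ListAction using (sum)
open import Data.List using (length; map; concat; concatMap; applyUpTo; reverse; inits; upTo; replicate;
  _++_; [_])
open import Data.List.Properties using (reverse-++; ++-identityʳ; length-++; length-replicate; filter-idem)
open import Data.List.Membership.Propositional using (_∈_)
open import Data.List.Membership.Propositional.Properties
  using (∈-map⁺; ∈-concatMap⁺; ∈-filter⁺; ∈-length; ∈-upTo⁺)
open import Data.List.Relation.Unary.All as All using (All; []; _∷_)
open import Data.List.Relation.Unary.All.Properties using (applyUpTo⁺₁; all⁻; map⁺; ++⁺; replicate⁺)
import Data.List.Relation.Unary.Any as Any
open import Data.List.Relation.Unary.Any using (here; there)
open import Data.Unit using (tt)
open import Data.Empty using (⊥-elim)
open import Function using (_∘_; Equivalence)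
open import Relation.Nullary.Decidable using (T?)

T-∧-intro : ∀ {a b} → T a → T b → T (a ∧ b)
T-∧-intro p q = Equivalence.from T-∧ (p , q)

T-and : ∀ {bs} → All T bs → T (and bs)
T-and [] = tt
T-and (p ∷ ps) = T-∧-intro p (T-and ps)

T-and-applyUpTo : ∀ f n → (∀ {i} → i < n → T (f i)) → T (and (applyUpTo f n))
T-and-applyUpTo f n h = T-and (applyUpTo⁺₁ f n h)

∈-concatMap⁺′ : ∀ {A B : Set} (f : A → List B) {x xs y} → x ∈ xs → y ∈ f x → y ∈ concatMap f xs
∈-concatMap⁺′ f x∈xs y∈fx = ∈-concatMap⁺ f (Any.map (λ { refl → y∈fx }) x∈xs)

∈⇒≤sum : ∀ {n ns} → n ∈ ns → n ≤ sum ns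
∈⇒≤sum {ns = n ∷ ns} (here refl) = m≤m+n n (sum ns)
∈⇒≤sum {ns = m ∷ ns} (there n∈ns) = ≤-trans (∈⇒≤sum n∈ns) (m≤n+m _ m)

at-beyond : ∀ xs {i} → length xs ≤ i → at xs i ≡ 0
at-beyond []       _         = refl
at-beyond (x ∷ xs) (s≤s len≤i) = at-beyond xs len≤i

at<length : ∀ xs i → 0 < at xs i → i < length xs
at<length (x ∷ xs) zero    _ = z<s
at<length (x ∷ xs) (suc i) p = s<s (at<length xs i p)

Entry : ℕ → ℕ → Set
Entry m e = 0 < e × e ≤ m

∈-words : ∀ m w → All (Entry m) w → w ∈ words (length w) m
∈-words m []          []                   = here refl
∈-words m (suc e ∷ w) ((_ , e<m) ∷ entries) =
  ∈-concatMap⁺′ (λ w → map (_∷ w) (map suc (upTo m))) (∈-words m w entries)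
                (∈-map⁺ (_∷ w) (∈-map⁺ suc (∈-upTo⁺ e<m)))

∈-fillings : ∀ m rows → All (All (Entry m)) rows → rows ∈ fillings (map length rows) m
∈-fillings m []         []                  = here refl
∈-fillings m (w ∷ rows) (entries ∷ entries′) =
  ∈-concatMap⁺′ (λ w → map (w ∷_) (fillings (map length rows) m)) (∈-words m w entries)
                (∈-map⁺ (w ∷_) (∈-fillings m rows entries′))

lrCount-pos : ∀ {γ α β} tab → T (contained α γ) →
  map length tab ≡ applyUpTo (λ i → at γ i ∸ at α i) (length γ) →
  All (All (Entry (length β))) tab → T (isLR γ α β tab) → 0 < lrCount γ α β
lrCount-pos {γ} {α} {β} tab α⊆γ shape entries isLR-tab with contained α γ
... | true  = ∈-length (∈-filter⁺ (T? ∘ isLR γ α β) tab∈ isLR-tab)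
  where
  tab∈ : tab ∈ fillings (applyUpTo (λ i → at γ i ∸ at α i) (length γ)) (length β)
  tab∈ = subst (λ rows → tab ∈ fillings rows (length β)) shape (∈-fillings (length β) tab entries)
... | false = ⊥-elim α⊆γ

count-++ : ∀ k xs ys → count k (xs ++ ys) ≡ count k xs + count k ys
count-++ k []       ys = refl
count-++ k (x ∷ xs) ys with x ≡ᵇ k
... | true  = cong suc (count-++ k xs ys)
... | false = count-++ k xs ys

count-replicate : ∀ k v n → count k (replicate n v) ≡ (if v ≡ᵇ k then n else 0)
count-replicate k v zero with v ≡ᵇ k
... | true  = refl
... | false = refl
count-replicate k v (suc n) with v ≡ᵇ k | count-replicate k v n
... | true  | ih = cong suc ih
... | false | ih = ih

Ballot : ℕ → List ℕ → Set
Ballot d w = All (λ p → count 2 p ≤ d + count 1 p) (inits w)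

ballot-1∷ : ∀ d w → Ballot (suc d) w → Ballot d (1 ∷ w)
ballot-1∷ d w b = z≤n ∷ map⁺ (All.map (λ {p} c≤ → ≤-trans c≤ (≤-reflexive (sym (+-suc d (count 1 p))))) b)

ballot-2∷ : ∀ d w → Ballot d w → Ballot (suc d) (2 ∷ w)
ballot-2∷ d w b = z≤n ∷ map⁺ (All.map s≤s b)

ballot-ones : ∀ d x → Ballot d (replicate x 1)
ballot-ones d zero    = z≤n ∷ []
ballot-ones d (suc x) = ballot-1∷ d (replicate x 1) (ballot-ones (suc d) x)

ballot-ones++ : ∀ r d w → Ballot (r + d) w → Ballot d (replicate r 1 ++ w)
ballot-ones++ zero    d w b = b
ballot-ones++ (suc r) d w b =
  ballot-1∷ d _ (ballot-ones++ r (suc d) w (subst (λ d′ → Ballot d′ w) (sym (+-suc r d)) b))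

ballot-twos++ : ∀ y d w → Ballot d w → Ballot (y + d) (replicate y 2 ++ w)
ballot-twos++ zero    d w b = b
ballot-twos++ (suc y) d w b = ballot-2∷ (y + d) _ (ballot-twos++ y d w b)

row : ℕ → ℕ → List ℕ
row x y = replicate x 1 ++ replicate y 2

length-row : ∀ x y → length (row x y) ≡ x + y
length-row x y = trans (length-++ (replicate x 1)) (cong₂ _+_ (length-replicate x) (length-replicate y))

weakInc-twos : ∀ y → T (weakInc (replicate y 2))
weakInc-twos zero          = tt
weakInc-twos (suc zero)    = tt
weakInc-twos (suc (suc y)) = weakInc-twos (suc y)

weakInc-row : ∀ x y → T (weakInc (row x y))
weakInc-row zero          y       = weakInc-twos y
weakInc-row (suc zero)    zero    = tt
weakInc-row (suc zero)    (suc y) = weakInc-twos (suc y)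
weakInc-row (suc (suc x)) y       = weakInc-row (suc x) y

at-row-ones : ∀ x y {i} → i < x → at (row x y) i ≡ 1
at-row-ones (suc x) y {zero}  _         = refl
at-row-ones (suc x) y {suc i} (s≤s i<x) = at-row-ones x y i<x

at-row-twos : ∀ x y {i} → i < y → at (row x y) (x + i) ≡ 2
at-row-twos zero    (suc y) {zero}  _         = refl
at-row-twos zero    (suc y) {suc i} (s≤s i<y) = at-row-twos zero y i<y
at-row-twos (suc x) y               i<y       = at-row-twos x y i<y

count-row : ∀ x y → count 1 (row x y) ≡ x × count 2 (row x y) ≡ y
count-row x y =
  trans (count-++ 1 (replicate x 1) _)
        (trans (cong₂ _+_ (count-replicate 1 1 x) (count-replicate 1 2 y)) (+-identityʳ x)) ,
  trans (count-++ 2 (replicate x 1) _) (cong₂ _+_ (count-replicate 2 1 x) (count-replicate 2 2 y))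

reverse-replicate : ∀ n (v : ℕ) → reverse (replicate n v) ≡ replicate n v
reverse-replicate zero    v = refl
reverse-replicate (suc n) v = begin
  reverse ([ v ] ++ replicate n v)  ≡⟨ reverse-++ [ v ] (replicate n v) ⟩
  reverse (replicate n v) ++ [ v ]  ≡⟨ cong (_++ [ v ]) (reverse-replicate n v) ⟩
  replicate n v ++ [ v ]            ≡⟨ replicate-∷ʳ n ⟩
  v ∷ replicate n v                 ∎
  where
  replicate-∷ʳ : ∀ n → replicate n v ++ [ v ] ≡ v ∷ replicate n v
  replicate-∷ʳ zero    = refl
  replicate-∷ʳ (suc n) = cong (v ∷_) (replicate-∷ʳ n)

reverse-row : ∀ x y → reverse (row x y) ≡ replicate y 2 ++ replicate x 1
reverse-row x y = begin
  reverse (replicate x 1 ++ replicate y 2)          ≡⟨ reverse-++ (replicate x 1) (replicate y 2) ⟩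
  reverse (replicate y 2) ++ reverse (replicate x 1) ≡⟨ cong₂ _++_ (reverse-replicate y 2) (reverse-replicate x 1) ⟩
  replicate y 2 ++ replicate x 1                    ∎

record TwoRowList (l : List ℕ) (v₁ v₂ : ℕ) : Set where
  field
    length≤2 : length l ≤ 2
    positive : All (0 <_) l
    first    : at l 0 ≡ v₁
    second   : at l 1 ≡ v₂

norm-twoRow : ∀ {v₁ v₂} → v₂ ≤ v₁ → TwoRowList (norm (v₁ ∷ v₂ ∷ [])) v₁ v₂
norm-twoRow {zero}   {zero}   _ = record { length≤2 = z≤n ; positive = [] ; first = refl ; second = refl }
norm-twoRow {zero}   {suc v₂} ()
norm-twoRow {suc v₁} {zero}   _ =
  record { length≤2 = s≤s z≤n ; positive = z<s ∷ [] ; first = refl ; second = refl }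
norm-twoRow {suc v₁} {suc v₂} _ =
  record { length≤2 = s≤s (s≤s z≤n) ; positive = z<s ∷ z<s ∷ [] ; first = refl ; second = refl }

twoRowList-empty : ∀ {l v₁ v₂} → TwoRowList l v₁ v₂ → v₁ ≡ 0 → l ≡ []
twoRowList-empty {[]}    _                                           _    = refl
twoRowList-empty {_ ∷ _} record { positive = p ∷ _ ; first = refl } refl = ⊥-elim (<-irrefl refl p)

at≤at : ∀ {α γ a₁ a₂ g₁ g₂} → TwoRowList α a₁ a₂ → TwoRowList γ g₁ g₂ → a₁ ≤ g₁ → a₂ ≤ g₂ →
        ∀ i → at α i ≤ at γ i
at≤at α γ a₁≤g₁ a₂≤g₂ zero = subst₂ _≤_ (sym (TwoRowList.first α)) (sym (TwoRowList.first γ)) a₁≤g₁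
at≤at α γ a₁≤g₁ a₂≤g₂ (suc zero) = subst₂ _≤_ (sym (TwoRowList.second α)) (sym (TwoRowList.second γ)) a₂≤g₂
at≤at {α = α} α-rows _ _ _ (suc (suc i)) =
  subst (_≤ _) (sym (at-beyond α (≤-trans (TwoRowList.length≤2 α-rows) (s≤s (s≤s z≤n))))) z≤n

length-mono : ∀ α γ → All (0 <_) α → (∀ i → at α i ≤ at γ i) → length α ≤ length γ
length-mono []      γ       _        _     = z≤n
length-mono (a ∷ α) []      (a>0 ∷ _) α≤γ = ⊥-elim (<-irrefl refl (<-≤-trans a>0 (α≤γ 0)))
length-mono (a ∷ α) (g ∷ γ) (_ ∷ α>0) α≤γ = s≤s (length-mono α γ α>0 (α≤γ ∘ suc))

contained-twoRow : ∀ {α γ a₁ a₂ g₁ g₂} → TwoRowList α a₁ a₂ → TwoRowList γ g₁ g₂ → a₁ ≤ g₁ → a₂ ≤ g₂ →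
                   T (contained α γ)
contained-twoRow {α} {γ} α-rows γ-rows a₁≤g₁ a₂≤g₂ =
  T-∧-intro (≤⇒≤ᵇ (length-mono α γ (TwoRowList.positive α-rows) α≤γ))
            (T-and-applyUpTo _ (length α) (λ {i} _ → ≤⇒≤ᵇ (α≤γ i)))
  where
  α≤γ : ∀ i → at α i ≤ at γ i
  α≤γ = at≤at α-rows γ-rows a₁≤g₁ a₂≤g₂

hasContent-twoRow : ∀ {β b₁ b₂} tab → TwoRowList β b₁ b₂ →
  count 1 (concat tab) ≡ b₁ → count 2 (concat tab) ≡ b₂ → T (hasContent β tab)
hasContent-twoRow {β} tab β-rows ones twos = T-and-applyUpTo _ (length β) content
  where
  open TwoRowList β-rows
  content : ∀ {k} → k < length β → T (count (suc k) (concat tab) ≡ᵇ at β k)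
  content {zero}        _   = ≡⇒≡ᵇ _ _ (trans ones (sym first))
  content {suc zero}    _   = ≡⇒≡ᵇ _ _ (trans twos (sym second))
  content {suc (suc k)} k<β with <-≤-trans k<β length≤2
  ... | s≤s (s≤s ())

lattice-ballot : ∀ m w → m ≤ 2 → Ballot 0 w → T (lattice m w)
lattice-ballot m w m≤2 ballot =
  all⁻ _ (All.map (λ {p} c₂≤c₁ → T-and-applyUpTo (λ k → count (suc (suc k)) p ≤ᵇ count (suc k) p) (m ∸ 1)
                                                 (step {p} c₂≤c₁)) ballot)
  where
  step : ∀ {p} → count 2 p ≤ count 1 p → ∀ {k} → k < m ∸ 1 → T (count (suc (suc k)) p ≤ᵇ count (suc k) p)
  step c₂≤c₁ {zero}  _   = ≤⇒≤ᵇ c₂≤c₁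
  step c₂≤c₁ {suc k} k<m with <-≤-trans k<m (∸-monoˡ-≤ 1 m≤2)
  ... | s≤s ()

ballot-readingWord : ∀ x y f → Ballot 0 (replicate (y + f) 1 ++ ((replicate y 2 ++ replicate x 1) ++ []))
ballot-readingWord x y f =
  ballot-ones++ (y + f) 0 _
    (subst₂ Ballot (sym (+-identityʳ (y + f))) (sym (++-identityʳ _)) (ballot-twos++ y f _ (ballot-ones f x)))

entries-row : ∀ {m} x y → (0 < x → 1 ≤ m) → (0 < y → 2 ≤ m) → All (Entry m) (row x y)
entries-row {m} x y 1≤m 2≤m = ++⁺ (entries x 1 z<s 1≤m) (entries y 2 z<s 2≤m)
  where
  entries : ∀ n v → 0 < v → (0 < n → v ≤ m) → All (Entry m) (replicate n v)
  entries zero    v _   _   = []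
  entries (suc n) v v>0 v≤m = replicate⁺ (suc n) (v>0 , v≤m z<s)

isLR-intro : ∀ γ α β tab → T (and (map weakInc tab)) → T (colStrict γ α tab) → T (hasContent β tab) →
             T (lattice (length β) (concat (map reverse tab))) → T (isLR γ α β tab)
isLR-intro γ α β tab rows columns content reading =
  T-∧-intro {and (map weakInc tab)} rows
    (T-∧-intro {colStrict γ α tab} columns
      (T-∧-intro {hasContent β tab} {lattice (length β) (concat (map reverse tab))} content reading))

<∸⇒+< : ∀ e b {j} → j < b ∸ e → e + j < b
<∸⇒+< zero    b       j<b   = j<b
<∸⇒+< (suc e) (suc b) j<b∸e = s<s (<∸⇒+< e b j<b∸e)

1≤length : ∀ {l v₁ v₂} → TwoRowList l v₁ v₂ → 0 < v₁ → 1 ≤ length l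
1≤length {l} rows v₁>0 = at<length l 0 (subst (0 <_) (sym (TwoRowList.first rows)) v₁>0)

2≤length : ∀ {l v₁ v₂} → TwoRowList l v₁ v₂ → 0 < v₂ → 2 ≤ length l
2≤length {l} rows v₂>0 = at<length l 1 (subst (0 <_) (sym (TwoRowList.second rows)) v₂>0)

column-increases : ∀ a₂ x e b₂ f {j} → j < (a₂ + x + b₂) ∸ (a₂ + x + e) →
  T (at (row (b₂ + f) 0) ((a₂ + x + e + j) ∸ (a₂ + x + e)) <ᵇ at (row x b₂) ((a₂ + x + e + j) ∸ a₂))
column-increases a₂ x e b₂ f {j} j< = subst₂ (λ p q → T (p <ᵇ q)) (sym top) (sym bottom) tt
  where
  e+j<b₂ : e + j < b₂
  e+j<b₂ = <∸⇒+< e b₂ (subst (j <_) ([m+n]∸[m+o]≡n∸o (a₂ + x) b₂ e) j<)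
  top : at (row (b₂ + f) 0) ((a₂ + x + e + j) ∸ (a₂ + x + e)) ≡ 1
  top = trans (cong (at (row (b₂ + f) 0)) (m+n∸m≡n (a₂ + x + e) j))
              (at-row-ones (b₂ + f) 0 (<-≤-trans (≤-<-trans (m≤n+m j e) e+j<b₂) (m≤m+n b₂ f)))
  bottom : at (row x b₂) ((a₂ + x + e + j) ∸ a₂) ≡ 2
  bottom = trans (cong (at (row x b₂)) (trans (cong (_∸ a₂) reassoc) (m+n∸m≡n a₂ (x + (e + j)))))
                 (at-row-twos x b₂ e+j<b₂)
    where
    vars : List ℕ
    vars = a₂ ∷ x ∷ e ∷ j ∷ []
    reassoc : a₂ + x + e + j ≡ a₂ + (x + (e + j))
    reassoc = solve vars

-- The tableau of shape γ/α: top row 1^(b₂ + f), bottom row 1^x 2^b₂.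
lrCount-twoRows : ∀ {g₀ g₁ α β a₂ x e b₂ f} →
  TwoRowList (g₀ ∷ g₁ ∷ []) ((a₂ + x + e) + (b₂ + f)) (a₂ + x + b₂) →
  TwoRowList α (a₂ + x + e) a₂ → TwoRowList β ((b₂ + f) + x) b₂ → 0 < lrCount (g₀ ∷ g₁ ∷ []) α β
lrCount-twoRows {α = α} {β} {a₂} {x} {e} {b₂} {f} γ-rows@record { first = refl ; second = refl } α-rows β-rows =
  lrCount-pos {γ} {α} {β} tab (contained-twoRow α-rows γ-rows (m≤m+n _ _) (≤-trans (m≤m+n a₂ x) (m≤m+n _ b₂)))
    shape entries
    (isLR-intro γ α β tab
      (all⁻ weakInc {xs = tab} (weakInc-row (b₂ + f) 0 ∷ weakInc-row x b₂ ∷ []))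
      (T-and (T-and-applyUpTo (λ j → at (row (b₂ + f) 0) ((at α 0 + j) ∸ at α 0)
                                     <ᵇ at (row x b₂) ((at α 0 + j) ∸ at α 1))
                              ((a₂ + x + b₂) ∸ at α 0) column ∷ []))
      (hasContent-twoRow tab β-rows ones twos)
      (lattice-ballot (length β) _ (TwoRowList.length≤2 β-rows)
        (subst (Ballot 0) (sym readingWord) (ballot-readingWord x b₂ f))))
  where
  open TwoRowList α-rows
  γ : List ℕ
  γ = (a₂ + x + e) + (b₂ + f) ∷ a₂ + x + b₂ ∷ []
  tab : List (List ℕ)
  tab = row (b₂ + f) 0 ∷ row x b₂ ∷ []
  shape : map length tab ≡ applyUpTo (λ i → at γ i ∸ at α i) 2
  shape = cong₂ (λ u v → u ∷ v ∷ []) (begin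
    length (row (b₂ + f) 0)               ≡⟨ trans (length-row (b₂ + f) 0) (+-identityʳ _) ⟩
    b₂ + f                                ≡⟨ m+n∸m≡n (a₂ + x + e) (b₂ + f) ⟨
    (a₂ + x + e) + (b₂ + f) ∸ (a₂ + x + e) ≡⟨ cong (_ ∸_) first ⟨
    (a₂ + x + e) + (b₂ + f) ∸ at α 0      ∎) (begin
    length (row x b₂)                     ≡⟨ length-row x b₂ ⟩
    x + b₂                                ≡⟨ m+n∸m≡n a₂ (x + b₂) ⟨
    a₂ + (x + b₂) ∸ a₂                    ≡⟨ cong₂ _∸_ (+-assoc a₂ x b₂) second ⟨
    a₂ + x + b₂ ∸ at α 1                  ∎)
  entries : All (All (Entry (length β))) tab
  entries = entries-row (b₂ + f) 0 (λ b₂+f>0 → 1≤length β-rows (≤-trans b₂+f>0 (m≤m+n _ x))) (λ ())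
          ∷ entries-row x b₂ (λ x>0 → 1≤length β-rows (≤-trans x>0 (m≤n+m x _))) (2≤length β-rows)
          ∷ []
  column : ∀ {j} → j < (a₂ + x + b₂) ∸ at α 0 →
           T (at (row (b₂ + f) 0) ((at α 0 + j) ∸ at α 0) <ᵇ at (row x b₂) ((at α 0 + j) ∸ at α 1))
  column {j} j< =
    subst₂ (λ p q → T (at (row (b₂ + f) 0) ((p + j) ∸ p) <ᵇ at (row x b₂) ((p + j) ∸ q))) (sym first) (sym second)
           (column-increases a₂ x e b₂ f (subst (λ p → j < (a₂ + x + b₂) ∸ p) first j<))
  ones : count 1 (concat tab) ≡ (b₂ + f) + x
  ones = trans (count-++ 1 (row (b₂ + f) 0) _)
               (cong₂ _+_ (proj₁ (count-row (b₂ + f) 0))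
                          (trans (cong (count 1) (++-identityʳ (row x b₂))) (proj₁ (count-row x b₂))))
  twos : count 2 (concat tab) ≡ b₂
  twos = trans (count-++ 2 (row (b₂ + f) 0) _)
               (cong₂ _+_ (proj₂ (count-row (b₂ + f) 0))
                          (trans (cong (count 2) (++-identityʳ (row x b₂))) (proj₂ (count-row x b₂))))
  readingWord : concat (map reverse tab) ≡ replicate (b₂ + f) 1 ++ ((replicate b₂ 2 ++ replicate x 1) ++ [])
  readingWord = cong₂ (λ u v → u ++ (v ++ [])) (reverse-row (b₂ + f) 0) (reverse-row x b₂)

lrCount-oneRow : ∀ {g₀ α β e f} → TwoRowList (g₀ ∷ []) (e + f) 0 → TwoRowList α e 0 → TwoRowList β (f + 0) 0 →
                 0 < lrCount (g₀ ∷ []) α β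
lrCount-oneRow {α = α} {β} {e} {f} γ-rows@record { first = refl } α-rows β-rows =
  lrCount-pos {γ} {α} {β} tab (contained-twoRow α-rows γ-rows (m≤m+n e f) z≤n) shape entries
    (isLR-intro γ α β tab (all⁻ weakInc {xs = tab} (weakInc-row f 0 ∷ [])) tt
      (hasContent-twoRow tab β-rows ones twos)
      (lattice-ballot (length β) _ (TwoRowList.length≤2 β-rows)
        (subst (Ballot 0) (sym readingWord) (ballot-readingWord 0 0 f))))
  where
  γ : List ℕ
  γ = e + f ∷ []
  tab : List (List ℕ)
  tab = row f 0 ∷ []
  shape : map length tab ≡ applyUpTo (λ i → at γ i ∸ at α i) 1
  shape = cong (_∷ []) (begin
    length (row f 0)    ≡⟨ trans (length-row f 0) (+-identityʳ f) ⟩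
    f                   ≡⟨ m+n∸m≡n e f ⟨
    e + f ∸ e           ≡⟨ cong (_ ∸_) (TwoRowList.first α-rows) ⟨
    e + f ∸ at α 0      ∎)
  entries : All (All (Entry (length β))) tab
  entries = entries-row f 0 (λ f>0 → 1≤length β-rows (≤-trans f>0 (m≤m+n f 0))) (λ ()) ∷ []
  ones : count 1 (concat tab) ≡ f + 0
  ones = trans (count-++ 1 (row f 0) []) (cong (_+ 0) (proj₁ (count-row f 0)))
  twos : count 2 (concat tab) ≡ 0
  twos = trans (count-++ 2 (row f 0) []) (cong (_+ 0) (proj₂ (count-row f 0)))
  readingWord : concat (map reverse tab) ≡ replicate f 1 ++ []
  readingWord = cong (_++ []) (reverse-row f 0)

sum³≡0 : ∀ p q r → p + q + r ≡ 0 → p ≡ 0 × q ≡ 0 × r ≡ 0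
sum³≡0 zero zero zero _ = refl , refl , refl

lrCount-atMostTwoRows : ∀ {γ α β a₂ x e b₂ f} →
  TwoRowList γ ((a₂ + x + e) + (b₂ + f)) (a₂ + x + b₂) →
  TwoRowList α (a₂ + x + e) a₂ → TwoRowList β ((b₂ + f) + x) b₂ → 0 < lrCount γ α β
lrCount-atMostTwoRows {[]} {a₂ = a₂} {x} {e} {b₂} {f} γ-rows α-rows β-rows
  with twoRowList-empty α-rows a₁≡0 | twoRowList-empty β-rows b₁≡0
  where
  a₁+[b₂+f]≡0 : (a₂ + x + e) + (b₂ + f) ≡ 0
  a₁+[b₂+f]≡0 = sym (TwoRowList.first γ-rows)
  a₁≡0 : a₂ + x + e ≡ 0
  a₁≡0 = m+n≡0⇒m≡0 _ a₁+[b₂+f]≡0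
  b₁≡0 : (b₂ + f) + x ≡ 0
  b₁≡0 = cong₂ _+_ (m+n≡0⇒n≡0 (a₂ + x + e) a₁+[b₂+f]≡0) (m+n≡0⇒n≡0 a₂ (m+n≡0⇒m≡0 _ a₁≡0))
... | refl | refl = z<s
lrCount-atMostTwoRows {_ ∷ []} {a₂ = a₂} {x} {b₂ = b₂} γ-rows α-rows β-rows
  with sum³≡0 a₂ x b₂ (sym (TwoRowList.second γ-rows))
... | refl , refl , refl = lrCount-oneRow γ-rows α-rows β-rows
lrCount-atMostTwoRows {_ ∷ _ ∷ []} γ-rows α-rows β-rows = lrCount-twoRows γ-rows α-rows β-rows
lrCount-atMostTwoRows {_ ∷ _ ∷ _ ∷ _} record { length≤2 = s≤s (s≤s ()) } _ _

clebschGordan-tableau : ∀ {g₁ g₂ a₁ a₂ b₁ b₂} → ClebschGordan g₁ g₂ a₁ a₂ b₁ b₂ →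
  ∃ λ ((x , e , f) : ℕ × ℕ × ℕ) →
    g₁ ≡ (a₂ + x + e) + (b₂ + f) × g₂ ≡ a₂ + x + b₂ × a₁ ≡ a₂ + x + e × b₁ ≡ (b₂ + f) + x
clebschGordan-tableau {g₁} {g₂} {a₁} {a₂} {b₁} {b₂} cg
  with m≤n⇒∃[o]m+o≡n (ClebschGordan.a₂+b₂≤g₂ cg)
... | x , refl
  with m≤n⇒∃[o]m+o≡n (ClebschGordan.g₂≤a₁+b₂ cg) | m≤n⇒∃[o]m+o≡n (ClebschGordan.g₂≤a₂+b₁ cg)
... | e , g₂+e≡a₁+b₂ | f , g₂+f≡a₂+b₁ = (x , e , f) , g₁≡ , solve vars , a₁≡ , b₁≡
  where
  vars : List ℕ
  vars = a₂ ∷ b₂ ∷ x ∷ e ∷ f ∷ []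
  a₁≡ : a₁ ≡ a₂ + x + e
  a₁≡ = +-cancelʳ-≡ b₂ a₁ (a₂ + x + e) (begin
    a₁ + b₂              ≡⟨ g₂+e≡a₁+b₂ ⟨
    (a₂ + b₂ + x) + e    ≡⟨ solve vars ⟩
    (a₂ + x + e) + b₂    ∎)
  b₁≡ : b₁ ≡ (b₂ + f) + x
  b₁≡ = +-cancelˡ-≡ a₂ b₁ ((b₂ + f) + x) (begin
    a₂ + b₁              ≡⟨ g₂+f≡a₂+b₁ ⟨
    (a₂ + b₂ + x) + f    ≡⟨ solve vars ⟩
    a₂ + ((b₂ + f) + x)  ∎)
  g₁≡ : g₁ ≡ (a₂ + x + e) + (b₂ + f)
  g₁≡ = +-cancelʳ-≡ (a₂ + b₂ + x) g₁ _ (begin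
    g₁ + (a₂ + b₂ + x)                            ≡⟨ ClebschGordan.|g|≡|a|+|b| cg ⟩
    (a₁ + a₂) + (b₁ + b₂)                         ≡⟨ cong₂ (λ p q → (p + a₂) + (q + b₂)) a₁≡ b₁≡ ⟩
    ((a₂ + x + e) + a₂) + (((b₂ + f) + x) + b₂)   ≡⟨ solve vars ⟩
    ((a₂ + x + e) + (b₂ + f)) + (a₂ + b₂ + x)     ∎)

LR-twoRow : ∀ {g₁ g₂ a₁ a₂ b₁ b₂} → ClebschGordan g₁ g₂ a₁ a₂ b₁ b₂ →
            0 < LR (g₁ ∷ g₂ ∷ []) (a₁ ∷ a₂ ∷ []) (b₁ ∷ b₂ ∷ [])
LR-twoRow {a₂ = a₂} {b₂ = b₂} cg with clebschGordan-tableau cg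
... | (x , e , f) , refl , refl , refl , refl =
  lrCount-atMostTwoRows (norm-twoRow (+-mono-≤ (m≤m+n (a₂ + x) e) (m≤m+n b₂ f)))
                 (norm-twoRow (≤-trans (m≤m+n a₂ x) (m≤m+n _ e)))
                 (norm-twoRow (≤-trans (m≤m+n b₂ f) (m≤m+n _ x)))

∈-partsF : ∀ {fuel n k q rest} → suc q ≤ k → q < suc n →
           rest ∈ partsF fuel (suc n ∸ suc q) (suc q) → (suc q ∷ rest) ∈ partsF (suc fuel) (suc n) k
∈-partsF {fuel} {n} {k} {q} {rest} q<k q≤n rest∈ =
  ∈-concatMap⁺′ (λ p → map (p ∷_) (partsF fuel (suc n ∸ p) p))
    (∈-filter⁺ (T? ∘ (_≤ᵇ k)) (∈-map⁺ suc (∈-upTo⁺ q≤n)) (≤⇒≤ᵇ q<k))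
    (∈-map⁺ (suc q ∷_) rest∈)

[]∈partsF : ∀ fuel n k → [] ∈ partsF fuel (n ∸ n) k
[]∈partsF fuel n k = subst (λ m → [] ∈ partsF fuel m k) (sym (n∸n≡0 n)) (here refl)

norm-∈-partitionsOf : ∀ {v₁ v₂} → v₂ ≤ v₁ → norm (v₁ ∷ v₂ ∷ []) ∈ partitionsOf (v₁ + v₂)
norm-∈-partitionsOf {zero}  {zero}  _ = here refl
norm-∈-partitionsOf {suc p} {zero}  _ =
  subst (λ n → (suc p ∷ []) ∈ partitionsOf n) (sym (+-identityʳ (suc p)))
        (∈-partsF ≤-refl ≤-refl ([]∈partsF p (suc p) (suc p)))
norm-∈-partitionsOf {suc p} {suc q} (s≤s q≤p) =
  subst (λ n → (suc p ∷ suc q ∷ []) ∈ partitionsOf n) (sym (cong suc (+-suc p q)))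
        (∈-partsF {fuel = suc (p + q)} {n = suc (p + q)} (s≤s p≤1+p+q) (s≤s p≤1+p+q)
          (subst (λ n → (suc q ∷ []) ∈ partsF (suc (p + q)) n (suc p)) (sym remaining)
            (∈-partsF {fuel = p + q} {n = q} (s≤s q≤p) ≤-refl ([]∈partsF (p + q) (suc q) (suc q)))))
  where
  p≤1+p+q : p ≤ suc (p + q)
  p≤1+p+q = ≤-trans (m≤m+n p q) (n≤1+n _)
  remaining : suc (p + q) ∸ p ≡ suc q
  remaining = trans (cong (_∸ p) (sym (+-suc p q))) (m+n∸m≡n p (suc q))

norm-∈-partitionsUpTo : ∀ {v₁ v₂ S} → v₂ ≤ v₁ → v₁ + v₂ ≤ S → norm (v₁ ∷ v₂ ∷ []) ∈ partitionsUpTo S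
norm-∈-partitionsUpTo v₂≤v₁ v≤S = ∈-concatMap⁺′ partitionsOf (∈-upTo⁺ (s≤s v≤S)) (norm-∈-partitionsOf v₂≤v₁)

norm-idempotent : ∀ l → norm (norm l) ≡ norm l
norm-idempotent = filter-idem (T? ∘ λ x → not (x ≡ᵇ 0))

LR-norm : ∀ γ α β → LR γ (norm α) (norm β) ≡ LR γ α β
LR-norm γ α β = cong₂ (lrCount (norm γ)) (norm-idempotent α) (norm-idempotent β)

size₂ : ∀ x y → x + y ≡ size (x ∷ y ∷ [])
size₂ x y = cong (x +_) (sym (+-identityʳ y))

module _ {g₁ g₂ a₁ a₂ b₁ b₂ : ℕ} (cg : ClebschGordan g₁ g₂ a₁ a₂ b₁ b₂) where
  open ClebschGordan cg

  left≤ : a₁ + a₂ ≤ size (g₁ ∷ g₂ ∷ [])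
  left≤ = ≤-trans (m≤m+n _ (b₁ + b₂)) (≤-reflexive (trans (sym |g|≡|a|+|b|) (size₂ g₁ g₂)))

  right≤ : b₁ + b₂ ≤ size (g₁ ∷ g₂ ∷ [])
  right≤ = ≤-trans (m≤n+m _ (a₁ + a₂)) (≤-reflexive (trans (sym |g|≡|a|+|b|) (size₂ g₁ g₂)))

  a₂≤a₁ : a₂ ≤ a₁
  a₂≤a₁ = +-cancelʳ-≤ b₂ a₂ a₁ (≤-trans a₂+b₂≤g₂ g₂≤a₁+b₂)

  b₂≤b₁ : b₂ ≤ b₁
  b₂≤b₁ = +-cancelˡ-≤ a₂ b₂ b₁ (≤-trans a₂+b₂≤g₂ g₂≤a₂+b₁)

*-pos : ∀ {m n} → 0 < m → 0 < n → 0 < m * n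
*-pos {suc m} {suc n} _ _ = z<s

LR-pos : ∀ {g₁ g₂ a₁ a₂ b₁ b₂} → ClebschGordan g₁ g₂ a₁ a₂ b₁ b₂ →
         0 < LR (g₁ ∷ g₂ ∷ []) (norm (a₁ ∷ a₂ ∷ [])) (norm (b₁ ∷ b₂ ∷ []))
LR-pos {g₁} {g₂} {a₁} {a₂} {b₁} {b₂} cg =
  subst (0 <_) (sym (LR-norm (g₁ ∷ g₂ ∷ []) (a₁ ∷ a₂ ∷ []) (b₁ ∷ b₂ ∷ []))) (LR-twoRow cg)

NL-pos : ∀ {m₁ m₂ n₁ n₂ l₁ l₂ a₁ a₂ b₁ b₂ c₁ c₂} →
  ClebschGordan m₁ m₂ a₁ a₂ b₁ b₂ → ClebschGordan n₁ n₂ a₁ a₂ c₁ c₂ → ClebschGordan l₁ l₂ b₁ b₂ c₁ c₂ →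
  0 < NL (m₁ ∷ m₂ ∷ []) (n₁ ∷ n₂ ∷ []) (l₁ ∷ l₂ ∷ [])
NL-pos {m₁} {m₂} {n₁} {n₂} {l₁} {l₂} {a₁} {a₂} {b₁} {b₂} {c₁} {c₂} cgμ cgν cgλ =
  <-≤-trans (*-pos (*-pos (LR-pos cgμ) (LR-pos cgν)) (LR-pos cgλ)) (∈⇒≤sum term∈)
  where
  μ ν ρ α β γ : List ℕ
  μ = m₁ ∷ m₂ ∷ []
  ν = n₁ ∷ n₂ ∷ []
  ρ = l₁ ∷ l₂ ∷ []
  α = norm (a₁ ∷ a₂ ∷ [])
  β = norm (b₁ ∷ b₂ ∷ [])
  γ = norm (c₁ ∷ c₂ ∷ [])
  summands : List ℕ → List ℕ → List ℕ
  summands α′ β′ = map (λ γ′ → LR μ α′ β′ * LR ν α′ γ′ * LR ρ β′ γ′) (partitionsUpTo (size ν))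
  term∈ : LR μ α β * LR ν α γ * LR ρ β γ ∈
          concatMap (λ α′ → concatMap (summands α′) (partitionsUpTo (size μ))) (partitionsUpTo (size μ))
  term∈ = ∈-concatMap⁺′ (λ α′ → concatMap (summands α′) (partitionsUpTo (size μ)))
            (norm-∈-partitionsUpTo (a₂≤a₁ cgμ) (left≤ cgμ))
            (∈-concatMap⁺′ (summands α) (norm-∈-partitionsUpTo (b₂≤b₁ cgμ) (right≤ cgμ))
              (∈-map⁺ (λ γ′ → LR μ α β * LR ν α γ′ * LR ρ β γ′)
                (norm-∈-partitionsUpTo (b₂≤b₁ cgν) (right≤ cgν))))

-- The inequalities of 𝒢₂

open import Data.Vec using (Vec; _∷_; [])
open import Data.Fin.Patterns using (0F; 1F)
open import Data.Fin.Subset as Subset using (Subset; ⁅_⁆)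
open import Data.Integer as ℤ using (0ℤ; drop‿+≤+) renaming (_≤_ to _≤ℤ_)
import Data.Integer.Properties as ℤ
open import Data.Integer.Tactic.RingSolver using (solve-∀)
open import Data.Nat.ListAction.Properties using (sum-++)

select : ∀ {n} → Subset n → Vec ℕ n → List ℕ
select []          []      = []
select (true ∷ A)  (x ∷ v) = x ∷ select A v
select (false ∷ A) (x ∷ v) = select A v

-- Unlike sum, this adds no trailing 0, so that the sum of an explicit list is already in
-- normal form.
sum⁺ : List ℕ → ℕ
sum⁺ []           = 0
sum⁺ (x ∷ [])     = x
sum⁺ (x ∷ y ∷ ys) = x + sum⁺ (y ∷ ys)

sum⁺≡sum : ∀ xs → sum⁺ xs ≡ sum xs
sum⁺≡sum []           = refl
sum⁺≡sum (x ∷ [])     = sym (+-identityʳ x)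
sum⁺≡sum (x ∷ y ∷ ys) = cong (x +_) (sum⁺≡sum (y ∷ ys))

sumOver≡sum-select : ∀ {n} (A : Subset n) (v : Vec ℕ n) → sumOver A v ≡ sum (select A v)
sumOver≡sum-select []          []      = refl
sumOver≡sum-select (true ∷ A)  (x ∷ v) = cong (x +_) (sumOver≡sum-select A v)
sumOver≡sum-select (false ∷ A) (x ∷ v) = sumOver≡sum-select A v

sumOver³≡sum⁺ : ∀ {n} (μ ν ρ : Vec ℕ n) (A B C : Subset n) →
  sumOver A μ + sumOver B ν + sumOver C ρ ≡ sum⁺ (select A μ ++ select B ν ++ select C ρ)
sumOver³≡sum⁺ μ ν ρ A B C = begin
  sumOver A μ + sumOver B ν + sumOver C ρ  ≡⟨ cong₂ _+_ (cong₂ _+_ (sumOver≡sum-select A μ) (sumOver≡sum-select B ν))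
                                                        (sumOver≡sum-select C ρ) ⟩
  sum xs + sum ys + sum zs                 ≡⟨ +-assoc (sum xs) (sum ys) (sum zs) ⟩
  sum xs + (sum ys + sum zs)               ≡⟨ cong (sum xs +_) (sum-++ ys zs) ⟨
  sum xs + sum (ys ++ zs)                  ≡⟨ sum-++ xs (ys ++ zs) ⟨
  sum (xs ++ ys ++ zs)                     ≡⟨ sum⁺≡sum (xs ++ ys ++ zs) ⟨
  sum⁺ (xs ++ ys ++ zs)                    ∎
  where
  xs ys zs : List ℕ
  xs = select A μ
  ys = select B ν
  zs = select C ρ

ineqForm≥0⇒≤ : ∀ {n} (μ ν ρ : Vec ℕ n) (A A' B B' C C' : Subset n) →
  0ℤ ≤ℤ ineqForm μ ν ρ A A' B B' C C' →
  sum⁺ (select A' μ ++ select B' ν ++ select C' ρ) ≤ sum⁺ (select A μ ++ select B ν ++ select C ρ)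
ineqForm≥0⇒≤ μ ν ρ A A' B B' C C' 0≤form =
  subst₂ _≤_ (sumOver³≡sum⁺ μ ν ρ A' B' C') (sumOver³≡sum⁺ μ ν ρ A B C) (drop‿+≤+ (ℤ.0≤i-j⇒j≤i 0≤P-N))
  where
  regroup : ∀ a a′ b b′ c c′ →
    ((((a ℤ.- a′) ℤ.+ b) ℤ.- b′) ℤ.+ c) ℤ.- c′ ≡ (a ℤ.+ b ℤ.+ c) ℤ.- (a′ ℤ.+ b′ ℤ.+ c′)
  regroup = solve-∀
  0≤P-N : 0ℤ ≤ℤ ℤ.+ (sumOver A μ + sumOver B ν + sumOver C ρ) ℤ.- ℤ.+ (sumOver A' μ + sumOver B' ν + sumOver C' ρ)
  0≤P-N = subst (0ℤ ≤ℤ_) (regroup (ℤ.+ sumOver A μ) (ℤ.+ sumOver A' μ) (ℤ.+ sumOver B ν)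
                                  (ℤ.+ sumOver B' ν) (ℤ.+ sumOver C ρ) (ℤ.+ sumOver C' ρ)) 0≤form

HornCondition : Vec ℕ 2 → Vec ℕ 2 → Vec ℕ 2 → Set
HornCondition μ ν ρ =
  (A A' B B' C C' : Subset 2) → InG 2 A A' B B' C C' → 0ℤ ≤ℤ ineqForm μ ν ρ A A' B B' C C'

[∅] [1] [2] [12] : Subset 2
[∅]  = Subset.⊥
[1]  = ⁅ 0F ⁆
[2]  = ⁅ 1F ⁆
[12] = Subset.⊤

-- Membership of (A, A', B, B', C, C') in 𝒢₂, witnessed by (A₁, A₂, B₁, B₂, C₁, C₂); every
-- remaining condition is decided by computation.
pattern 𝒢₂-member A₁ A₂ B₁ B₂ C₁ C₂ =
  (refl , refl , refl) , (refl , refl , refl) , A₁ , A₂ , B₁ , B₂ , C₁ , C₂ ,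
  (refl , refl , refl , refl , refl , refl) , (z<s , z<s , z<s) , (z<s , z<s , z<s)

≤-rearrange : ∀ {l r l′ r′} → l ≤ r → l ≡ l′ → r ≡ r′ → l′ ≤ r′
≤-rearrange l≤r refl refl = l≤r

-- Each inequality is read off from one member of 𝒢₂; horn states it in normal form, listing the
-- rows of μ, ν, λ in that order.
module HornFacts {m₂ s n₂ t l₂ u : ℕ}
  (H : HornCondition ((m₂ + s) ∷ m₂ ∷ []) ((n₂ + t) ∷ n₂ ∷ []) ((l₂ + u) ∷ l₂ ∷ [])) where

  μ ν ρ : Vec ℕ 2
  μ = (m₂ + s) ∷ m₂ ∷ []
  ν = (n₂ + t) ∷ n₂ ∷ []
  ρ = (l₂ + u) ∷ l₂ ∷ []

  horn : ∀ A A' B B' C C' → InG 2 A A' B B' C C' →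
         sum⁺ (select A' μ ++ select B' ν ++ select C' ρ) ≤ sum⁺ (select A μ ++ select B ν ++ select C ρ)
  horn A A' B B' C C' w = ineqForm≥0⇒≤ μ ν ρ A A' B B' C C' (H A A' B B' C C' w)

  vars : List ℕ
  vars = m₂ ∷ s ∷ n₂ ∷ t ∷ l₂ ∷ u ∷ []

  hornμ : HornInequalities m₂ s n₂ t l₂ u
  hornμ = record
    { m₁+n₂≤m₂+n₁+|λ| = horn [2] [1] [1] [2] [12] [∅] (𝒢₂-member [1] [1] [2] [1] [∅] [∅])
    ; m₁+l₂≤m₂+l₁+|ν| = horn [2] [1] [12] [∅] [1] [2] (𝒢₂-member [1] [1] [∅] [∅] [1] [2])
    ; l₂≤m₂+n₁        = horn [2] [∅] [1] [∅] [∅] [2] (𝒢₂-member [∅] [∅] [∅] [∅] [1] [2])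
    ; n₂≤m₂+l₁        = horn [2] [∅] [∅] [2] [1] [∅] (𝒢₂-member [∅] [∅] [2] [1] [∅] [∅])
    ; m₁≤n₁+l₁        = horn [∅] [1] [1] [∅] [1] [∅] (𝒢₂-member [1] [1] [∅] [∅] [∅] [∅])
    }

  m₂+n₁≤m₁+n₂+|λ| : m₂ + (n₂ + t) ≤ (m₂ + s) + (n₂ + ((l₂ + u) + l₂))
  m₂+n₁≤m₁+n₂+|λ| = horn [1] [2] [2] [1] [12] [∅] (𝒢₂-member [1] [2] [1] [1] [∅] [∅])

  n₁+l₂≤|μ|+n₂+l₁ : (n₂ + t) + l₂ ≤ (m₂ + s) + (m₂ + (n₂ + (l₂ + u)))
  n₁+l₂≤|μ|+n₂+l₁ = horn [12] [∅] [2] [1] [1] [2] (𝒢₂-member [∅] [∅] [1] [1] [2] [1])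

  l₂≤m₁+n₂ : l₂ ≤ (m₂ + s) + n₂
  l₂≤m₁+n₂ = horn [1] [∅] [2] [∅] [∅] [2] (𝒢₂-member [∅] [∅] [∅] [∅] [2] [1])

  hornν : HornInequalities n₂ t m₂ s l₂ u
  hornν = record
    { m₁+n₂≤m₂+n₁+|λ| = ≤-rearrange m₂+n₁≤m₁+n₂+|λ| (solve vars) (solve vars)
    ; m₁+l₂≤m₂+l₁+|ν| = ≤-rearrange n₁+l₂≤|μ|+n₂+l₁ refl (solve vars)
    ; l₂≤m₂+n₁        = ≤-rearrange l₂≤m₁+n₂ refl (solve vars)
    ; n₂≤m₂+l₁        = horn [∅] [2] [2] [∅] [1] [∅] (𝒢₂-member [1] [2] [∅] [∅] [∅] [∅])
    ; m₁≤n₁+l₁        = horn [1] [∅] [∅] [1] [1] [∅] (𝒢₂-member [∅] [∅] [1] [1] [∅] [∅])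
    }

  m₂+l₁≤m₁+|ν|+l₂ : m₂ + (l₂ + u) ≤ (m₂ + s) + ((n₂ + t) + (n₂ + l₂))
  m₂+l₁≤m₁+|ν|+l₂ = horn [1] [2] [12] [∅] [2] [1] (𝒢₂-member [2] [1] [∅] [∅] [1] [1])

  n₂+l₁≤|μ|+n₁+l₂ : n₂ + (l₂ + u) ≤ (m₂ + s) + (m₂ + ((n₂ + t) + l₂))
  n₂+l₁≤|μ|+n₁+l₂ = horn [12] [∅] [1] [2] [2] [1] (𝒢₂-member [∅] [∅] [1] [2] [1] [1])

  n₂≤m₁+l₂ : n₂ ≤ (m₂ + s) + l₂
  n₂≤m₁+l₂ = horn [1] [∅] [∅] [2] [2] [∅] (𝒢₂-member [∅] [∅] [1] [2] [∅] [∅])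

  m₂≤n₁+l₂ : m₂ ≤ (n₂ + t) + l₂
  m₂≤n₁+l₂ = horn [∅] [2] [1] [∅] [2] [∅] (𝒢₂-member [2] [1] [∅] [∅] [∅] [∅])

  hornλ : HornInequalities l₂ u m₂ s n₂ t
  hornλ = record
    { m₁+n₂≤m₂+n₁+|λ| = ≤-rearrange m₂+l₁≤m₁+|ν|+l₂ (solve vars) (solve vars)
    ; m₁+l₂≤m₂+l₁+|ν| = ≤-rearrange n₂+l₁≤|μ|+n₁+l₂ (solve vars) (solve vars)
    ; l₂≤m₂+n₁        = ≤-rearrange n₂≤m₁+l₂ refl (solve vars)
    ; n₂≤m₂+l₁        = ≤-rearrange m₂≤n₁+l₂ refl (solve vars)
    ; m₁≤n₁+l₁        = horn [1] [∅] [1] [∅] [∅] [1] (𝒢₂-member [∅] [∅] [∅] [∅] [1] [1])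
    }

  |μ|≤|ν|+|λ| : (m₂ + s) + m₂ ≤ ((n₂ + t) + n₂) + ((l₂ + u) + l₂)
  |μ|≤|ν|+|λ| = ≤-rearrange (horn [∅] [12] [12] [∅] [12] [∅] (𝒢₂-member [12] [12] [∅] [∅] [∅] [∅]))
                  refl (sym (+-assoc (n₂ + t) n₂ _))

  |ν|≤|μ|+|λ| : (n₂ + t) + n₂ ≤ ((m₂ + s) + m₂) + ((l₂ + u) + l₂)
  |ν|≤|μ|+|λ| = ≤-rearrange (horn [12] [∅] [∅] [12] [12] [∅] (𝒢₂-member [∅] [∅] [12] [12] [∅] [∅]))
                  refl (sym (+-assoc (m₂ + s) m₂ _))

  |λ|≤|μ|+|ν| : (l₂ + u) + l₂ ≤ ((m₂ + s) + m₂) + ((n₂ + t) + n₂)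
  |λ|≤|μ|+|ν| = ≤-rearrange (horn [12] [∅] [12] [∅] [∅] [12] (𝒢₂-member [∅] [∅] [∅] [∅] [12] [12]))
                  refl (sym (+-assoc (m₂ + s) m₂ _))

proposition2p10 : (μ ν ρ : Vec ℕ 2) → IsPar μ → IsPar ν → IsPar ρ
    → 2 ∣ (size (asPartition μ) + size (asPartition ν) + size (asPartition ρ))
    → ((A A' B B' C C' : Subset 2) → InG 2 A A' B B' C C'
         → 0ℤ ≤ℤ ineqForm μ ν ρ A A' B B' C C')
    → 0 < NL (asPartition μ) (asPartition ν) (asPartition ρ)
proposition2p10 (m₁ ∷ m₂ ∷ []) (n₁ ∷ n₂ ∷ []) (l₁ ∷ l₂ ∷ []) μ-par ν-par ρ-par (divides q total) H
  with m≤n⇒∃[o]m+o≡n (μ-par 0F 1F z≤n) | m≤n⇒∃[o]m+o≡n (ν-par 0F 1F z≤n) | m≤n⇒∃[o]m+o≡n (ρ-par 0F 1F z≤n)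
... | s , refl | t , refl | u , refl =
  let open HornFacts H
      ((a , b , c) , a+b , a+c , b+c) = vertexSizes q |λ|≤|μ|+|ν| |ν|≤|μ|+|λ| |μ|≤|ν|+|λ|
        (trans (cong₂ _+_ (cong₂ _+_ (size₂ (m₂ + s) m₂) (size₂ (n₂ + t) n₂)) (size₂ (l₂ + u) l₂)) total)
      (_ , cgμ , cgν , cgλ) = twoRowSolution {m₂ = m₂} {n₂ = n₂} {l₂ = l₂} a+b a+c b+c
        (spinInequalities {a} {b} {c} a+b a+c b+c hornμ)
        (spinInequalities {a} {c} {b} a+c a+b (trans (+-comm c b) b+c) hornν)
        (spinInequalities {b} {c} {a} b+c (trans (+-comm b a) a+b) (trans (+-comm c a) a+c) hornλ)
  in NL-pos cgμ cgν cgλ
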